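{- Let $n\in\mathbb{N}$ and let $S_n$ be the total number of brushes of a $1$-clique configuration of $K_n$. Then there exists a $1$-clique configuration of $K_{3n+1}$ using $2S_n+3n^2+2n$ brushes.
   Context: $K_n$ is the complete graph on $n$ vertices. Parallel cleaning process on a graph $G=(V,E)$ with initial configuration $\omega_0:V\to\mathbb{N}\cup\{0\}$: $D_0=V$, $t=0$; $D_t(v)=|N(v)\cap D_t|$ if $v\in D_t$, else $0$; $\rho_{t+1}=\{v\in D_t:\omega_t(v)\ge D_t(v)\}$; if $\rho_{t+1}=\emptyset$ stop with $K=t$, final dirty set $D_K$ and final configuration $\omega_K$; otherwise $D_{t+1}=D_t\setminus\rho_{t+1}$, $\omega_{t+1}(v)=\omega_t(v)-D_t(v)+|N(v)\cap\rho_{t+1}|$ for $v\in\rho_{t+1}$, $\omega_{t+1}(u)=\omega_t(u)+|N(u)\cap\rho_{t+1}|$ for $u\in D_{t+1}$, other values unchanged, and repeat with $t+1$. $\omega_0$ cleans $G$ if $D_K=\emptyset$. A $1$-clique configuration of $K_n$ (vertices $v_0,\dots,v_{n-1}$) is an initial configuration $\omega_0$ that cleans $K_n$ with final configuration $\omega_K$ such that (1) $\omega_0(v_i)\le n-1$ for all $i$, and (2) there is a one-to-one correspondence between the elements of $\{\omega_0(v_0),\dots,\omega_0(v_{n-1})\}$ and $\{\omega_K(v_0),\dots,\omega_K(v_{n-1})\}$ (i.e. $\omega_K$ is obtained from $\omega_0$ by relabeling the vertices). The number of brushes used by $\omega_0$ is $\sum_i\omega_0(v_i)$. -}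

module Defs where

open import Data.Nat using (ℕ; zero; suc; _+_; _∸_; _≤_; _≤ᵇ_)
open import Data.Fin using (Fin; zero; suc; _≟_)
open import Data.Fin.Permutation using (Permutation′; _⟨$⟩ʳ_)
open import Data.Bool using (Bool; true; false; if_then_else_; _∧_; not)
open import Data.Product using (Σ; ∃; _×_)
open import Relation.Nullary.Decidable using (isYes)
open import Relation.Binary.PropositionalEquality using (_≡_)

-- A configuration on the vertex set Fin n (brushes at each vertex).
Config : ℕ → Set
Config n = Fin n → ℕ

VSet : ℕ → Set
VSet n = Fin n → Bool

sumFin : ∀ {n} → (Fin n → ℕ) → ℕ
sumFin {zero}  f = 0
sumFin {suc n} f = f zero + sumFin (λ i → f (suc i))

card : ∀ {n} → VSet n → ℕ
card S = sumFin (λ i → if S i then 1 else 0)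

adjK : ∀ {n} → Fin n → Fin n → Bool
adjK v u = not (isYes (v ≟ u))

nbrCount : ∀ {n} → Fin n → VSet n → ℕ
nbrCount v S = card (λ u → adjK v u ∧ S u)

dirtyDeg : ∀ {n} → VSet n → Fin n → ℕ
dirtyDeg D v = if D v then nbrCount v D else 0

rho : ∀ {n} → VSet n → Config n → VSet n
rho D ω v = D v ∧ (dirtyDeg D v ≤ᵇ ω v)

nextD : ∀ {n} → VSet n → Config n → VSet n
nextD D ω v = D v ∧ not (rho D ω v)

nextω : ∀ {n} → VSet n → Config n → Config n
nextω D ω v =
  if rho D ω v then (ω v ∸ dirtyDeg D v) + nbrCount v (rho D ω)
  else (if nextD D ω v then ω v + nbrCount v (rho D ω) else ω v)

-- Runs D ω D' ω' : the parallel cleaning process on K_n started from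
-- dirty set D and configuration ω stops with dirty set D' and configuration ω'.
data Runs {n : ℕ} : VSet n → Config n → VSet n → Config n → Set where
  stop : ∀ {D ω} → (∀ v → rho D ω v ≡ false) → Runs D ω D ω
  step : ∀ {D ω DK ωK} → (∃ λ v → rho D ω v ≡ true) →
         Runs (nextD D ω) (nextω D ω) DK ωK → Runs D ω DK ωK

CleansWithFinal : ∀ {n} → Config n → Config n → Set
CleansWithFinal {n} ω₀ ωK =
  Σ (VSet n) λ DK → Runs (λ _ → true) ω₀ DK ωK × (∀ v → DK v ≡ false)

OneClique : ∀ n → Config n → Set
OneClique n ω₀ =
  (∀ v → ω₀ v ≤ n ∸ 1) ×
  (Σ (Config n) λ ωK → CleansWithFinal ω₀ ωK ×
     (Σ (Permutation′ n) λ σ → ∀ v → ωK v ≡ ω₀ (σ ⟨$⟩ʳ v)))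

brushes : ∀ {n} → Config n → ℕ
brushes = sumFin

-- Lay K_{3n+1} out as a high and a low copy of K_n plus n+1 middle vertices, and start the high
-- copy of i with ω i + (2n+1) brushes, the low copy with ω i and every middle vertex with n.
-- While the original process still has a dirty vertex, no low or middle vertex can fire, so each
-- dirty high vertex sees exactly 2n+1 more dirty neighbours and holds 2n+1 more brushes than its
-- original: the high copy replays the process on K_n round by round, while every cleaned vertex
-- sends one brush to each low and middle vertex. Once the high copy is clean the middle vertices
-- fire, giving each low vertex n+1 further brushes, and in the next round the whole low copy fires.
-- The final configuration is the initial one with the two copies exchanged, and the brush count
-- is (S + n(2n+1)) + S + (n+1)n.

module Submission where

open import Data.Bool.Base using (Bool; true; false; if_then_else_; _∧_; not)
import Data.Bool.Properties as Bool
open import Data.Empty using (⊥-elim)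
open import Data.Fin.Base using (Fin; zero; suc; _↑ˡ_; _↑ʳ_; splitAt)
open import Data.Fin.Permutation using (Permutation′; _⟨$⟩ʳ_; _⟨$⟩ˡ_; permutation; inverseˡ; inverseʳ)
open import Data.Fin.Properties using (_≟_; any?; splitAt-↑ˡ; splitAt-↑ʳ; splitAt⁻¹-↑ˡ; splitAt⁻¹-↑ʳ)
open import Data.Nat.Base using (ℕ; zero; suc; _+_; _*_; _∸_; _≤_; _<_; _≤ᵇ_; z≤n; z<s; s≤s)
open import Data.Nat.Properties hiding (_≟_)
open import Algebra.Properties.CommutativeSemigroup +-commutativeSemigroup using (interchange; xy∙z≈xz∙y)
open import Data.Nat.Tactic.RingSolver using (solve-∀)
open import Data.Product.Base using (Σ; ∃; _×_; _,_)
open import Data.Sum.Base using (_⊎_; inj₁; inj₂; [_,_]′)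
open import Function.Base using (_∘_; const)
open import Function.Bundles using (mk⇔)
open import Relation.Nullary.Decidable using (does; yes; no; ⌊⌋-map′; does-⇔; dec-true; dec-false)
open import Relation.Binary.PropositionalEquality

open import Defs

≡true⊎≡false : ∀ b → b ≡ true ⊎ b ≡ false
≡true⊎≡false true  = inj₁ refl
≡true⊎≡false false = inj₂ refl

⟦_⟧ : Bool → ℕ
⟦ b ⟧ = if b then 1 else 0

sumFin-cong : ∀ {n} {f g : Fin n → ℕ} → (∀ i → f i ≡ g i) → sumFin f ≡ sumFin g
sumFin-cong {zero}  f≗g = refl
sumFin-cong {suc n} f≗g = cong₂ _+_ (f≗g zero) (sumFin-cong (f≗g ∘ suc))

sumFin-distrib-+ : ∀ {n} (f g : Fin n → ℕ) → sumFin (λ i → f i + g i) ≡ sumFin f + sumFin g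
sumFin-distrib-+ {zero}  f g = refl
sumFin-distrib-+ {suc n} f g =
  trans (cong (f zero + g zero +_) (sumFin-distrib-+ (f ∘ suc) (g ∘ suc)))
        (interchange (f zero) (g zero) _ _)

sumFin-const : ∀ n c → sumFin {n} (const c) ≡ n * c
sumFin-const zero    c = refl
sumFin-const (suc n) c = cong (c +_) (sumFin-const n c)

sumFin-↑ : ∀ m k (f : Fin (m + k) → ℕ) → sumFin f ≡ sumFin (f ∘ (_↑ˡ k)) + sumFin (f ∘ (m ↑ʳ_))
sumFin-↑ zero    k f = refl
sumFin-↑ (suc m) k f = trans (cong (f zero +_) (sumFin-↑ m k (f ∘ suc))) (sym (+-assoc (f zero) _ _))

card-cong : ∀ {n} {S T : VSet n} → (∀ v → S v ≡ T v) → card S ≡ card T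
card-cong S≗T = sumFin-cong (cong ⟦_⟧ ∘ S≗T)

nbrCount-cong : ∀ {n} (v : Fin n) {S T : VSet n} → (∀ u → S u ≡ T u) → nbrCount v S ≡ nbrCount v T
nbrCount-cong v S≗T = sumFin-cong (λ u → cong (λ b → ⟦ adjK v u ∧ b ⟧) (S≗T u))

card-≤ : ∀ {n} (S : VSet n) → card S ≤ n
card-≤ {zero}  S = z≤n
card-≤ {suc n} S with S zero
... | true  = s≤s (card-≤ (S ∘ suc))
... | false = m≤n⇒m≤1+n (card-≤ (S ∘ suc))

adjK-suc : ∀ {n} (v u : Fin n) → adjK (suc v) (suc u) ≡ adjK v u
adjK-suc v u = cong not (⌊⌋-map′ _ _ (v ≟ u))

nbrCount+⟦∈⟧≡card : ∀ {n} (v : Fin n) (S : VSet n) → nbrCount v S + ⟦ S v ⟧ ≡ card S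
nbrCount+⟦∈⟧≡card {suc n} zero    S = +-comm (card (S ∘ suc)) ⟦ S zero ⟧
nbrCount+⟦∈⟧≡card {suc n} (suc v) S = begin
  ⟦ S zero ⟧ + sumFin (λ u → ⟦ adjK (suc v) (suc u) ∧ S (suc u) ⟧) + ⟦ S (suc v) ⟧
    ≡⟨ cong (λ x → ⟦ S zero ⟧ + x + ⟦ S (suc v) ⟧)
            (sumFin-cong (λ u → cong (λ b → ⟦ b ∧ S (suc u) ⟧) (adjK-suc v u))) ⟩
  ⟦ S zero ⟧ + nbrCount v (S ∘ suc) + ⟦ S (suc v) ⟧
    ≡⟨ +-assoc ⟦ S zero ⟧ _ _ ⟩
  ⟦ S zero ⟧ + (nbrCount v (S ∘ suc) + ⟦ S (suc v) ⟧)
    ≡⟨ cong (⟦ S zero ⟧ +_) (nbrCount+⟦∈⟧≡card v (S ∘ suc)) ⟩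
  card S ∎
  where open ≡-Reasoning

nbrCount-∈ : ∀ {n} (v : Fin n) (S : VSet n) → S v ≡ true → suc (nbrCount v S) ≡ card S
nbrCount-∈ v S v∈S = trans (sym (+-comm (nbrCount v S) 1))
  (subst (λ b → nbrCount v S + ⟦ b ⟧ ≡ card S) v∈S (nbrCount+⟦∈⟧≡card v S))

nbrCount-∉ : ∀ {n} (v : Fin n) (S : VSet n) → S v ≡ false → nbrCount v S ≡ card S
nbrCount-∉ v S v∉S = trans (sym (+-identityʳ (nbrCount v S)))
  (subst (λ b → nbrCount v S + ⟦ b ⟧ ≡ card S) v∉S (nbrCount+⟦∈⟧≡card v S))

nbrCount≤card : ∀ {n} (v : Fin n) (S : VSet n) → nbrCount v S ≤ card S
nbrCount≤card v S = subst (nbrCount v S ≤_) (nbrCount+⟦∈⟧≡card v S) (m≤m+n _ _)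

card-∅ : ∀ n → card {n} (const false) ≡ 0
card-∅ n = trans (sumFin-const n 0) (*-zeroʳ n)

card-all : ∀ n → card {n} (const true) ≡ n
card-all n = trans (sumFin-const n 1) (*-identityʳ n)

module _ {n} (D : VSet n) (ω : Config n) (v : Fin n) where

  rho-clean : D v ≡ false → rho D ω v ≡ false
  rho-clean v∉D rewrite v∉D = refl

  rho-dirty : D v ≡ true → rho D ω v ≡ does (nbrCount v D ≤? ω v)
  rho-dirty v∈D rewrite v∈D = refl

  rho-fires : D v ≡ true → nbrCount v D ≤ ω v → rho D ω v ≡ true
  rho-fires v∈D enough = trans (rho-dirty v∈D) (dec-true (_ ≤? _) enough)

  rho-stays : D v ≡ true → ω v < nbrCount v D → rho D ω v ≡ false
  rho-stays v∈D short = trans (rho-dirty v∈D) (dec-false (_ ≤? _) (<⇒≱ short))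

  rho⇒dirty : rho D ω v ≡ true → D v ≡ true
  rho⇒dirty fires with D v
  ... | true = refl

  nextD-clean : D v ≡ false → nextD D ω v ≡ false
  nextD-clean v∉D rewrite v∉D = refl

  nextD-fires : rho D ω v ≡ true → nextD D ω v ≡ false
  nextD-fires fires rewrite fires = Bool.∧-zeroʳ (D v)

  nextD-stays : D v ≡ true → rho D ω v ≡ false → nextD D ω v ≡ true
  nextD-stays v∈D stays rewrite stays | v∈D = refl

  nextω-clean : D v ≡ false → nextω D ω v ≡ ω v
  nextω-clean v∉D rewrite rho-clean v∉D | v∉D = refl

  nextω-fires : rho D ω v ≡ true → nextω D ω v ≡ (ω v ∸ nbrCount v D) + nbrCount v (rho D ω)
  nextω-fires fires rewrite fires | rho⇒dirty fires = refl

  nextω-stays : D v ≡ true → rho D ω v ≡ false → nextω D ω v ≡ ω v + nbrCount v (rho D ω)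
  nextω-stays v∈D stays rewrite stays | v∈D = refl

rho⇒0<card : ∀ {n} (D : VSet n) (ω : Config n) v → rho D ω v ≡ true → 0 < card D
rho⇒0<card D ω v fires = subst (0 <_) (nbrCount-∈ v D (rho⇒dirty D ω v fires)) z<s

card≡card-nextD+card-rho : ∀ {n} (D : VSet n) (ω : Config n) → card D ≡ card (nextD D ω) + card (rho D ω)
card≡card-nextD+card-rho D ω =
  trans (sumFin-cong split) (sumFin-distrib-+ (⟦_⟧ ∘ nextD D ω) (⟦_⟧ ∘ rho D ω))
  where
  split : ∀ v → ⟦ D v ⟧ ≡ ⟦ nextD D ω v ⟧ + ⟦ rho D ω v ⟧
  split v with D v
  ... | false = refl
  ... | true with nbrCount v D ≤ᵇ ω v
  ...   | true  = refl
  ...   | false = refl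

n∸card-nextD : ∀ {n} (D : VSet n) (ω : Config n) → n ∸ card (nextD D ω) ≡ (n ∸ card D) + card (rho D ω)
n∸card-nextD {n} D ω = sym (begin
  (n ∸ card D) + r   ≡⟨ cong (λ c → (n ∸ c) + r) split ⟩
  (n ∸ (a + r)) + r  ≡⟨ +-∸-comm r (subst (_≤ n) split (card-≤ D)) ⟨
  (n + r) ∸ (a + r)  ≡⟨ cong₂ _∸_ (+-comm n r) (+-comm a r) ⟩
  (r + n) ∸ (r + a)  ≡⟨ [m+n]∸[m+o]≡n∸o r n a ⟩
  n ∸ a              ∎)
  where
  open ≡-Reasoning
  a r : ℕ
  a = card (nextD D ω)
  r = card (rho D ω)
  split : card D ≡ a + r
  split = card≡card-nextD+card-rho D ω

Cleans : ∀ {n} → VSet n → Config n → Config n → Set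
Cleans {n} D ω ωK = Σ (VSet n) λ DK → Runs D ω DK ωK × (∀ v → DK v ≡ false)

cleans-step : ∀ {n} {D : VSet n} {ω ωK : Config n} → (∃ λ v → rho D ω v ≡ true) →
              Cleans (nextD D ω) (nextω D ω) ωK → Cleans D ω ωK
cleans-step fires (DK , runs , clean) = DK , step fires runs , clean

cleans-inOneRound : ∀ {n} (D : VSet n) (ω : Config n) →
                    (∀ v → D v ≡ true → nbrCount v D ≤ ω v) →
                    ∃ λ ωK → Cleans D ω ωK × (∀ v → ωK v ≡ ω v)
cleans-inOneRound D ω enough with any? (λ v → D v Bool.≟ true)
... | yes (v , v∈D) =
  nextω D ω , cleans-step (v , trans (allFire v) v∈D) (nextD D ω , stop nothingLeft , cleaned) , unchanged
  where
  allFire : ∀ u → rho D ω u ≡ D u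
  allFire u with ≡true⊎≡false (D u)
  ... | inj₁ u∈D = trans (rho-fires D ω u u∈D (enough u u∈D)) (sym u∈D)
  ... | inj₂ u∉D = trans (rho-clean D ω u u∉D) (sym u∉D)

  cleaned : ∀ u → nextD D ω u ≡ false
  cleaned u with ≡true⊎≡false (D u)
  ... | inj₁ u∈D = nextD-fires D ω u (trans (allFire u) u∈D)
  ... | inj₂ u∉D = nextD-clean D ω u u∉D

  nothingLeft : ∀ u → rho (nextD D ω) (nextω D ω) u ≡ false
  nothingLeft u = rho-clean (nextD D ω) (nextω D ω) u (cleaned u)

  unchanged : ∀ u → nextω D ω u ≡ ω u
  unchanged u with ≡true⊎≡false (D u)
  ... | inj₂ u∉D = nextω-clean D ω u u∉D
  ... | inj₁ u∈D = begin
    nextω D ω u                                ≡⟨ nextω-fires D ω u (trans (allFire u) u∈D) ⟩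
    (ω u ∸ nbrCount u D) + nbrCount u (rho D ω) ≡⟨ cong ((ω u ∸ nbrCount u D) +_) (nbrCount-cong u allFire) ⟩
    (ω u ∸ nbrCount u D) + nbrCount u D         ≡⟨ m∸n+n≡m (enough u u∈D) ⟩
    ω u                                         ∎
    where open ≡-Reasoning
... | no noneDirty = ω , (D , stop (λ u → rho-clean D ω u (clean u)) , clean) , λ _ → refl
  where
  clean : ∀ u → D u ≡ false
  clean u with ≡true⊎≡false (D u)
  ... | inj₁ u∈D = ⊥-elim (noneDirty (u , u∈D))
  ... | inj₂ u∉D = u∉D

module Layout (n : ℕ) where

  N : ℕ
  N = 3 * n + 1

  data Role : Set where
    high low : Fin n → Role
    middle   : Role

  byRole : ∀ {A : Set} → (Fin n → A) → (Fin n → A) → A → Role → A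
  byRole h l m (high i) = h i
  byRole h l m (low i)  = l i
  byRole h l m middle   = m

  -- 3 * n + 1 unfolds to (n + (n + (n + 0))) + 1, which is why the blocks below are 2 * n and 1 * n.
  private
    role₂ : Fin (2 * n) → Role
    role₂ b = [ low , const middle ]′ (splitAt n b)

    role₃ : Fin (3 * n) → Role
    role₃ a = [ high , role₂ ]′ (splitAt n a)

  role : Fin N → Role
  role v = [ role₃ , const middle ]′ (splitAt (3 * n) v)

  hi lo : Fin n → Fin N
  hi i = (i ↑ˡ 2 * n) ↑ˡ 1
  lo i = (n ↑ʳ (i ↑ˡ 1 * n)) ↑ˡ 1

  role-hi : ∀ i → role (hi i) ≡ high i
  role-hi i rewrite splitAt-↑ˡ (3 * n) (i ↑ˡ 2 * n) 1 | splitAt-↑ˡ n i (2 * n) = refl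

  role-lo : ∀ i → role (lo i) ≡ low i
  role-lo i rewrite splitAt-↑ˡ (3 * n) (n ↑ʳ (i ↑ˡ 1 * n)) 1 | splitAt-↑ʳ n (2 * n) (i ↑ˡ 1 * n)
                  | splitAt-↑ˡ n i (1 * n) = refl

  lastVertex : Fin N
  lastVertex = 3 * n ↑ʳ zero

  role-lastVertex : role lastVertex ≡ middle
  role-lastVertex rewrite splitAt-↑ʳ (3 * n) 1 zero = refl

  private
    mi : Fin (1 * n) → Fin N
    mi j = (n ↑ʳ (n ↑ʳ j)) ↑ˡ 1

    role-mi : ∀ j → role (mi j) ≡ middle
    role-mi j rewrite splitAt-↑ˡ (3 * n) (n ↑ʳ (n ↑ʳ j)) 1 | splitAt-↑ʳ n (2 * n) (n ↑ʳ j)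
                    | splitAt-↑ʳ n (1 * n) j = refl

  data RoleView : Fin N → Set where
    high   : ∀ i → RoleView (hi i)
    low    : ∀ i → RoleView (lo i)
    middle : ∀ {v} → role v ≡ middle → RoleView v

  roleView : ∀ v → RoleView v
  roleView v with splitAt (3 * n) v in e₁
  ... | inj₂ _ = middle (cong [ role₃ , const middle ]′ e₁)
  ... | inj₁ a with splitAt n a in e₂
  ...   | inj₁ i = subst RoleView (trans (cong (_↑ˡ 1) (splitAt⁻¹-↑ˡ e₂)) (splitAt⁻¹-↑ˡ e₁)) (high i)
  ...   | inj₂ b with splitAt n b in e₃
  ...     | inj₁ i = subst RoleView (trans (cong (λ x → (n ↑ʳ x) ↑ˡ 1) (splitAt⁻¹-↑ˡ e₃))
                                     (trans (cong (_↑ˡ 1) (splitAt⁻¹-↑ʳ e₂)) (splitAt⁻¹-↑ˡ e₁))) (low i)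
  ...     | inj₂ _ = middle (trans (cong [ role₃ , const middle ]′ e₁)
                                 (trans (cong [ high , role₂ ]′ e₂) (cong [ low , const middle ]′ e₃)))

  sumFin-byRole : ∀ (f : Fin N → ℕ) c → (∀ {v} → role v ≡ middle → f v ≡ c) →
                  sumFin f ≡ sumFin (f ∘ hi) + sumFin (f ∘ lo) + suc n * c
  sumFin-byRole f c f-middle = begin
    sumFin f
      ≡⟨ sumFin-↑ (3 * n) 1 f ⟩
    sumFin (λ a → f (a ↑ˡ 1)) + (f lastVertex + 0)
      ≡⟨ cong (_+ (f lastVertex + 0)) (sumFin-↑ n (2 * n) (λ a → f (a ↑ˡ 1))) ⟩
    sumFin (f ∘ hi) + sumFin (λ b → f ((n ↑ʳ b) ↑ˡ 1)) + (f lastVertex + 0)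
      ≡⟨ cong (λ x → sumFin (f ∘ hi) + x + (f lastVertex + 0)) (sumFin-↑ n (1 * n) (λ b → f ((n ↑ʳ b) ↑ˡ 1))) ⟩
    sumFin (f ∘ hi) + (sumFin (f ∘ lo) + sumFin (f ∘ mi)) + (f lastVertex + 0)
      ≡⟨ cong₂ (λ x y → sumFin (f ∘ hi) + (sumFin (f ∘ lo) + x) + (y + 0))
               (trans (sumFin-cong (f-middle ∘ role-mi)) (sumFin-const (1 * n) c)) (f-middle role-lastVertex) ⟩
    sumFin (f ∘ hi) + (sumFin (f ∘ lo) + 1 * n * c) + (c + 0)
      ≡⟨ regroup (sumFin (f ∘ hi)) (sumFin (f ∘ lo)) n c ⟩
    sumFin (f ∘ hi) + sumFin (f ∘ lo) + suc n * c ∎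
    where
    open ≡-Reasoning
    regroup : ∀ a b n c → a + (b + 1 * n * c) + (c + 0) ≡ a + b + suc n * c
    regroup = solve-∀

  card-byRole : ∀ (S : VSet N) (A : VSet n) (bL bM : Bool) →
                (∀ i → S (hi i) ≡ A i) → (∀ i → S (lo i) ≡ bL) → (∀ {v} → role v ≡ middle → S v ≡ bM) →
                card S ≡ card A + n * ⟦ bL ⟧ + suc n * ⟦ bM ⟧
  card-byRole S A bL bM S-hi S-lo S-middle =
    trans (sumFin-byRole (⟦_⟧ ∘ S) ⟦ bM ⟧ (cong ⟦_⟧ ∘ S-middle))
          (cong₂ (λ x y → x + y + suc n * ⟦ bM ⟧)
                 (card-cong S-hi) (trans (sumFin-cong (cong ⟦_⟧ ∘ S-lo)) (sumFin-const n ⟦ bL ⟧)))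

  module _ (π : Permutation′ n) where

    private
      to from : Fin N → Fin N
      to   v = byRole (lo ∘ (π ⟨$⟩ʳ_)) hi v (role v)
      from v = byRole lo (hi ∘ (π ⟨$⟩ˡ_)) v (role v)

      to-hi : ∀ i → to (hi i) ≡ lo (π ⟨$⟩ʳ i)
      to-hi i = cong (byRole (lo ∘ (π ⟨$⟩ʳ_)) hi (hi i)) (role-hi i)

      to-lo : ∀ i → to (lo i) ≡ hi i
      to-lo i = cong (byRole (lo ∘ (π ⟨$⟩ʳ_)) hi (lo i)) (role-lo i)

      to-middle : ∀ {v} → role v ≡ middle → to v ≡ v
      to-middle {v} = cong (byRole (lo ∘ (π ⟨$⟩ʳ_)) hi v)

      from-hi : ∀ i → from (hi i) ≡ lo i
      from-hi i = cong (byRole lo (hi ∘ (π ⟨$⟩ˡ_)) (hi i)) (role-hi i)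

      from-lo : ∀ i → from (lo i) ≡ hi (π ⟨$⟩ˡ i)
      from-lo i = cong (byRole lo (hi ∘ (π ⟨$⟩ˡ_)) (lo i)) (role-lo i)

      from-middle : ∀ {v} → role v ≡ middle → from v ≡ v
      from-middle {v} = cong (byRole lo (hi ∘ (π ⟨$⟩ˡ_)) v)

    exchange : Permutation′ N
    exchange = permutation to from to∘from from∘to
      where
      to∘from : ∀ v → to (from v) ≡ v
      to∘from v with roleView v
      ... | high i       = trans (cong to (from-hi i)) (to-lo i)
      ... | low i        = trans (cong to (from-lo i)) (trans (to-hi _) (cong lo (inverseʳ π)))
      ... | middle v-mid = trans (cong to (from-middle v-mid)) (to-middle v-mid)

      from∘to : ∀ v → from (to v) ≡ v
      from∘to v with roleView v
      ... | high i       = trans (cong from (to-hi i)) (trans (from-lo _) (cong hi (inverseˡ π)))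
      ... | low i        = trans (cong from (to-lo i)) (from-hi i)
      ... | middle v-mid = trans (cong from (to-middle v-mid)) (from-middle v-mid)

    exchange-hi : ∀ i → exchange ⟨$⟩ʳ hi i ≡ lo (π ⟨$⟩ʳ i)
    exchange-hi = to-hi

    exchange-lo : ∀ i → exchange ⟨$⟩ʳ lo i ≡ hi i
    exchange-lo = to-lo

    exchange-middle : ∀ {v} → role v ≡ middle → exchange ⟨$⟩ʳ v ≡ v
    exchange-middle = to-middle

module Simulation (n : ℕ) (ω₀ : Config n) (ω₀<n : ∀ i → ω₀ i < n) where

  open Layout n

  K : ℕ
  K = suc (n + n)

  -- n ∸ card D is the number of vertices cleaned so far; each of them has sent one brush to every
  -- low and middle vertex.
  record Simulates (D′ : VSet N) (ω′ : Config N) (D : VSet n) (ω : Config n) : Set where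
    field
      hi-dirty       : ∀ i → D′ (hi i) ≡ D i
      hi-brushes     : ∀ i → ω′ (hi i) ≡ (if D i then ω i + K else ω i)
      lo-dirty       : ∀ i → D′ (lo i) ≡ true
      lo-brushes     : ∀ i → ω′ (lo i) ≡ ω₀ i + (n ∸ card D)
      middle-dirty   : ∀ {v} → role v ≡ middle → D′ v ≡ true
      middle-brushes : ∀ {v} → role v ≡ middle → ω′ v ≡ n + (n ∸ card D)

  module _ {D′ ω′ D ω} (R : Simulates D′ ω′ D ω) where

    open Simulates R

    card-D′ : card D′ ≡ card D + K
    card-D′ = trans (card-byRole D′ D true true hi-dirty lo-dirty middle-dirty) (count (card D) n)
      where
      count : ∀ c n → c + n * 1 + suc n * 1 ≡ c + suc (n + n)
      count = solve-∀

    nbrCount-D′ : ∀ v → D′ v ≡ true → nbrCount v D′ ≡ card D + (n + n)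
    nbrCount-D′ v v∈D′ = suc-injective (trans (nbrCount-∈ v D′ v∈D′) (trans card-D′ (+-suc (card D) (n + n))))

    nbrCount-hi-D′ : ∀ i → D i ≡ true → nbrCount (hi i) D′ ≡ nbrCount i D + K
    nbrCount-hi-D′ i i∈D = begin
      nbrCount (hi i) D′           ≡⟨ nbrCount-D′ (hi i) (trans (hi-dirty i) i∈D) ⟩
      card D + (n + n)             ≡⟨ cong (_+ (n + n)) (nbrCount-∈ i D i∈D) ⟨
      suc (nbrCount i D) + (n + n) ≡⟨ +-suc (nbrCount i D) (n + n) ⟨
      nbrCount i D + K             ∎
      where open ≡-Reasoning

    hi-brushes-dirty : ∀ i → D i ≡ true → ω′ (hi i) ≡ ω i + K
    hi-brushes-dirty i i∈D = trans (hi-brushes i) (cong (λ b → if b then ω i + K else ω i) i∈D)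

    hi-brushes-clean : ∀ i → D i ≡ false → ω′ (hi i) ≡ ω i
    hi-brushes-clean i i∉D = trans (hi-brushes i) (cong (λ b → if b then ω i + K else ω i) i∉D)

    rho-hi : ∀ i → rho D′ ω′ (hi i) ≡ rho D ω i
    rho-hi i with ≡true⊎≡false (D i)
    ... | inj₂ i∉D = trans (rho-clean D′ ω′ (hi i) (trans (hi-dirty i) i∉D)) (sym (rho-clean D ω i i∉D))
    ... | inj₁ i∈D = begin
      rho D′ ω′ (hi i)                        ≡⟨ rho-dirty D′ ω′ (hi i) (trans (hi-dirty i) i∈D) ⟩
      does (nbrCount (hi i) D′ ≤? ω′ (hi i))  ≡⟨ cong₂ (λ a b → does (a ≤? b)) (nbrCount-hi-D′ i i∈D)
                                                                              (hi-brushes-dirty i i∈D) ⟩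
      does (nbrCount i D + K ≤? ω i + K)      ≡⟨ does-⇔ (mk⇔ (+-cancelʳ-≤ K (nbrCount i D) (ω i)) (+-monoˡ-≤ K)) (_ ≤? _) (_ ≤? _) ⟩
      does (nbrCount i D ≤? ω i)              ≡⟨ rho-dirty D ω i i∈D ⟨
      rho D ω i                               ∎
      where open ≡-Reasoning

    rho-lo : ∀ i → rho D′ ω′ (lo i) ≡ false
    rho-lo i = rho-stays D′ ω′ (lo i) (lo-dirty i) (begin-strict
      ω′ (lo i)            ≡⟨ lo-brushes i ⟩
      ω₀ i + (n ∸ card D)  <⟨ +-mono-<-≤ (ω₀<n i) (m∸n≤m n (card D)) ⟩
      n + n                ≤⟨ m≤n+m (n + n) (card D) ⟩
      card D + (n + n)     ≡⟨ nbrCount-D′ (lo i) (lo-dirty i) ⟨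
      nbrCount (lo i) D′   ∎)
      where open ≤-Reasoning

    rho-middle : 0 < card D → ∀ {v} → role v ≡ middle → rho D′ ω′ v ≡ false
    rho-middle D≢∅ {v} v-mid = rho-stays D′ ω′ v (middle-dirty v-mid) (begin-strict
      ω′ v              ≡⟨ middle-brushes v-mid ⟩
      n + (n ∸ card D)  <⟨ +-monoʳ-< n (≤-<-trans (m∸n≤m n (card D)) (m<n+m n D≢∅)) ⟩
      n + (card D + n)  ≡⟨ +-comm n (card D + n) ⟩
      card D + n + n    ≡⟨ +-assoc (card D) n n ⟩
      card D + (n + n)  ≡⟨ nbrCount-D′ v (middle-dirty v-mid) ⟨
      nbrCount v D′     ∎)
      where open ≤-Reasoning

    module _ (D≢∅ : 0 < card D) where

      private
        ρ : VSet n
        ρ = rho D ω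
        ρ′ : VSet N
        ρ′ = rho D′ ω′

      card-ρ′ : card ρ′ ≡ card ρ
      card-ρ′ = trans (card-byRole ρ′ ρ false false rho-hi rho-lo (rho-middle D≢∅)) (count (card ρ) n)
        where
        count : ∀ c n → c + n * 0 + suc n * 0 ≡ c
        count = solve-∀

      nbrCount-hi-ρ′ : ∀ i → nbrCount (hi i) ρ′ ≡ nbrCount i ρ
      nbrCount-hi-ρ′ i = +-cancelʳ-≡ ⟦ ρ i ⟧ _ _ (begin
        nbrCount (hi i) ρ′ + ⟦ ρ i ⟧         ≡⟨ cong (λ b → nbrCount (hi i) ρ′ + ⟦ b ⟧) (rho-hi i) ⟨
        nbrCount (hi i) ρ′ + ⟦ ρ′ (hi i) ⟧   ≡⟨ nbrCount+⟦∈⟧≡card (hi i) ρ′ ⟩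
        card ρ′                              ≡⟨ card-ρ′ ⟩
        card ρ                               ≡⟨ nbrCount+⟦∈⟧≡card i ρ ⟨
        nbrCount i ρ + ⟦ ρ i ⟧               ∎)
        where open ≡-Reasoning

      nextω-waiting : ∀ {v} → D′ v ≡ true → ρ′ v ≡ false → nextω D′ ω′ v ≡ ω′ v + card ρ
      nextω-waiting {v} v∈D′ stays =
        trans (nextω-stays D′ ω′ v v∈D′ stays) (cong (ω′ v +_) (trans (nbrCount-∉ v ρ′ stays) card-ρ′))

      hi-brushes-next : ∀ i → nextω D′ ω′ (hi i) ≡ (if nextD D ω i then nextω D ω i + K else nextω D ω i)
      hi-brushes-next i with ≡true⊎≡false (D i)
      ... | inj₂ i∉D = begin
        nextω D′ ω′ (hi i)  ≡⟨ nextω-clean D′ ω′ (hi i) (trans (hi-dirty i) i∉D) ⟩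
        ω′ (hi i)           ≡⟨ hi-brushes-clean i i∉D ⟩
        ω i                 ≡⟨ nextω-clean D ω i i∉D ⟨
        nextω D ω i         ≡⟨ cong (λ b → if b then nextω D ω i + K else nextω D ω i) (nextD-clean D ω i i∉D) ⟨
        _                   ∎
        where open ≡-Reasoning
      ... | inj₁ i∈D with ≡true⊎≡false (ρ i)
      ...   | inj₁ fires = begin
        nextω D′ ω′ (hi i)
          ≡⟨ nextω-fires D′ ω′ (hi i) (trans (rho-hi i) fires) ⟩
        (ω′ (hi i) ∸ nbrCount (hi i) D′) + nbrCount (hi i) ρ′
          ≡⟨ cong₂ (λ x y → (x ∸ y) + nbrCount (hi i) ρ′) (hi-brushes-dirty i i∈D) (nbrCount-hi-D′ i i∈D) ⟩
        (ω i + K ∸ (nbrCount i D + K)) + nbrCount (hi i) ρ′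
          ≡⟨ cong₂ _+_ (trans (cong₂ _∸_ (+-comm (ω i) K) (+-comm (nbrCount i D) K))
                              ([m+n]∸[m+o]≡n∸o K (ω i) (nbrCount i D)))
                       (nbrCount-hi-ρ′ i) ⟩
        (ω i ∸ nbrCount i D) + nbrCount i ρ
          ≡⟨ nextω-fires D ω i fires ⟨
        nextω D ω i
          ≡⟨ cong (λ b → if b then nextω D ω i + K else nextω D ω i) (nextD-fires D ω i fires) ⟨
        _ ∎
        where open ≡-Reasoning
      ...   | inj₂ stays = begin
        nextω D′ ω′ (hi i)              ≡⟨ nextω-stays D′ ω′ (hi i) (trans (hi-dirty i) i∈D) (trans (rho-hi i) stays) ⟩
        ω′ (hi i) + nbrCount (hi i) ρ′  ≡⟨ cong₂ _+_ (hi-brushes-dirty i i∈D) (nbrCount-hi-ρ′ i) ⟩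
        ω i + K + nbrCount i ρ          ≡⟨ xy∙z≈xz∙y (ω i) K (nbrCount i ρ) ⟩
        ω i + nbrCount i ρ + K          ≡⟨ cong (_+ K) (nextω-stays D ω i i∈D stays) ⟨
        nextω D ω i + K                 ≡⟨ cong (λ b → if b then nextω D ω i + K else nextω D ω i)
                                                (nextD-stays D ω i i∈D stays) ⟨
        _                               ∎
        where open ≡-Reasoning

      simulates-next : Simulates (nextD D′ ω′) (nextω D′ ω′) (nextD D ω) (nextω D ω)
      simulates-next = record
        { hi-dirty       = λ i → cong₂ (λ d r → d ∧ not r) (hi-dirty i) (rho-hi i)
        ; hi-brushes     = hi-brushes-next
        ; lo-dirty       = λ i → nextD-stays D′ ω′ (lo i) (lo-dirty i) (rho-lo i)
        ; lo-brushes     = λ i → trans (nextω-waiting (lo-dirty i) (rho-lo i))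
                                       (trans (cong (_+ card ρ) (lo-brushes i)) (cleaned (ω₀ i)))
        ; middle-dirty   = λ v-mid → nextD-stays D′ ω′ _ (middle-dirty v-mid) (rho-middle D≢∅ v-mid)
        ; middle-brushes = λ v-mid → trans (nextω-waiting (middle-dirty v-mid) (rho-middle D≢∅ v-mid))
                                           (trans (cong (_+ card ρ) (middle-brushes v-mid)) (cleaned n))
        }
        where
        cleaned : ∀ x → x + (n ∸ card D) + card ρ ≡ x + (n ∸ card (nextD D ω))
        cleaned x = trans (+-assoc x _ _) (cong (x +_) (sym (n∸card-nextD D ω)))

  record Finished (ωK : Config n) (ωK′ : Config N) : Set where
    field
      hi-final     : ∀ i → ωK′ (hi i) ≡ ωK i
      lo-final     : ∀ i → ωK′ (lo i) ≡ ω₀ i + K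
      middle-final : ∀ {v} → role v ≡ middle → ωK′ v ≡ n

  module _ {D′ ω′ D ω} (R : Simulates D′ ω′ D ω) (D≡∅ : ∀ i → D i ≡ false) where

    open Simulates R

    private
      D₁ ρ₁ : VSet N
      D₁ = nextD D′ ω′
      ρ₁ = rho D′ ω′
      ω₁ : Config N
      ω₁ = nextω D′ ω′

      card-D : card D ≡ 0
      card-D = trans (card-cong D≡∅) (card-∅ n)

      hi-clean : ∀ i → D′ (hi i) ≡ false
      hi-clean i = trans (hi-dirty i) (D≡∅ i)

      ρ₁-hi : ∀ i → ρ₁ (hi i) ≡ false
      ρ₁-hi i = rho-clean D′ ω′ (hi i) (hi-clean i)

      ρ₁-middle : ∀ {v} → role v ≡ middle → ρ₁ v ≡ true
      ρ₁-middle {v} v-mid = rho-fires D′ ω′ v (middle-dirty v-mid) (≤-reflexive (begin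
        nbrCount v D′     ≡⟨ nbrCount-D′ R v (middle-dirty v-mid) ⟩
        card D + (n + n)  ≡⟨ cong (λ c → c + (n + n)) card-D ⟩
        n + n             ≡⟨ cong (λ c → n + (n ∸ c)) card-D ⟨
        n + (n ∸ card D)  ≡⟨ middle-brushes v-mid ⟨
        ω′ v              ∎))
        where open ≡-Reasoning

      card-ρ₁ : card ρ₁ ≡ suc n
      card-ρ₁ = trans (card-byRole ρ₁ (const false) false true ρ₁-hi (rho-lo R) ρ₁-middle)
                      (trans (cong (λ c → c + n * 0 + suc n * 1) (card-∅ n)) (count n))
        where
        count : ∀ n → 0 + n * 0 + suc n * 1 ≡ suc n
        count = solve-∀

      D₁-lo : ∀ i → D₁ (lo i) ≡ true
      D₁-lo i = nextD-stays D′ ω′ (lo i) (lo-dirty i) (rho-lo R i)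

      card-D₁ : card D₁ ≡ n
      card-D₁ = trans (card-byRole D₁ (const false) true false
                         (λ i → nextD-clean D′ ω′ (hi i) (hi-clean i)) D₁-lo
                         (λ v-mid → nextD-fires D′ ω′ _ (ρ₁-middle v-mid)))
                      (trans (cong (λ c → c + n * 1 + suc n * 0) (card-∅ n)) (count n))
        where
        count : ∀ n → 0 + n * 1 + suc n * 0 ≡ n
        count = solve-∀

      ω₁-hi : ∀ i → ω₁ (hi i) ≡ ω i
      ω₁-hi i = trans (nextω-clean D′ ω′ (hi i) (hi-clean i)) (hi-brushes-clean R i (D≡∅ i))

      ω₁-lo : ∀ i → ω₁ (lo i) ≡ ω₀ i + K
      ω₁-lo i = begin
        ω₁ (lo i)                              ≡⟨ nextω-stays D′ ω′ (lo i) (lo-dirty i) (rho-lo R i) ⟩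
        ω′ (lo i) + nbrCount (lo i) ρ₁         ≡⟨ cong₂ _+_ (lo-brushes i) (nbrCount-∉ (lo i) ρ₁ (rho-lo R i)) ⟩
        ω₀ i + (n ∸ card D) + card ρ₁          ≡⟨ cong₂ (λ c r → ω₀ i + (n ∸ c) + r) card-D card-ρ₁ ⟩
        ω₀ i + n + suc n                       ≡⟨ +-assoc (ω₀ i) n (suc n) ⟩
        ω₀ i + (n + suc n)                     ≡⟨ cong (ω₀ i +_) (+-suc n n) ⟩
        ω₀ i + K                               ∎
        where open ≡-Reasoning

      ω₁-middle : ∀ {v} → role v ≡ middle → ω₁ v ≡ n
      ω₁-middle {v} v-mid = begin
        ω₁ v                                   ≡⟨ nextω-fires D′ ω′ v (ρ₁-middle v-mid) ⟩
        (ω′ v ∸ nbrCount v D′) + nbrCount v ρ₁ ≡⟨ cong₂ _+_ (cong₂ _∸_ (middle-brushes v-mid)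
                                                                      (nbrCount-D′ R v (middle-dirty v-mid)))
                                                           (suc-injective (trans (nbrCount-∈ v ρ₁ (ρ₁-middle v-mid)) card-ρ₁)) ⟩
        (n + (n ∸ card D) ∸ (card D + (n + n))) + n
                                               ≡⟨ cong (λ c → (n + (n ∸ c) ∸ (c + (n + n))) + n) card-D ⟩
        (n + n ∸ (n + n)) + n                  ≡⟨ cong (_+ n) (n∸n≡0 (n + n)) ⟩
        n                                      ∎
        where open ≡-Reasoning

      D₁-enough : ∀ v → D₁ v ≡ true → nbrCount v D₁ ≤ ω₁ v
      D₁-enough v v∈D₁ with roleView v
      ... | high i       = ⊥-elim (Bool.not-¬ (nextD-clean D′ ω′ (hi i) (hi-clean i)) v∈D₁)
      ... | middle v-mid = ⊥-elim (Bool.not-¬ (nextD-fires D′ ω′ v (ρ₁-middle v-mid)) v∈D₁)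
      ... | low i        = begin
        nbrCount (lo i) D₁  ≤⟨ nbrCount≤card (lo i) D₁ ⟩
        card D₁             ≡⟨ card-D₁ ⟩
        n                   ≤⟨ m≤n⇒m≤1+n (m≤m+n n n) ⟩
        K                   ≤⟨ m≤n+m K (ω₀ i) ⟩
        ω₀ i + K            ≡⟨ ω₁-lo i ⟨
        ω₁ (lo i)           ∎
        where open ≤-Reasoning

    finish : ∃ λ ωK′ → Cleans D′ ω′ ωK′ × Finished ω ωK′
    finish with cleans-inOneRound D₁ ω₁ D₁-enough
    ... | ωK′ , cleans , ωK′≡ω₁ =
      ωK′ , cleans-step (lastVertex , ρ₁-middle role-lastVertex) cleans , record
        { hi-final     = λ i → trans (ωK′≡ω₁ (hi i)) (ω₁-hi i)
        ; lo-final     = λ i → trans (ωK′≡ω₁ (lo i)) (ω₁-lo i)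
        ; middle-final = λ {v} v-mid → trans (ωK′≡ω₁ v) (ω₁-middle v-mid)
        }

  simulate : ∀ {D′ ω′ D ω DK ωK} → Simulates D′ ω′ D ω → Runs D ω DK ωK → (∀ v → DK v ≡ false) →
             ∃ λ ωK′ → Cleans D′ ω′ ωK′ × Finished ωK ωK′
  simulate R (stop _) DK≡∅ = finish R DK≡∅
  simulate {D = D} {ω} R (step (w , w-fires) runs) DK≡∅
    with simulate (simulates-next R (rho⇒0<card D ω w w-fires)) runs DK≡∅
  ... | ωK′ , cleans , finished = ωK′ , cleans-step (hi w , trans (rho-hi R w) w-fires) cleans , finished

  ω₀′ : Config N
  ω₀′ v = byRole (λ i → ω₀ i + K) ω₀ n (role v)

  ω₀′-hi : ∀ i → ω₀′ (hi i) ≡ ω₀ i + K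
  ω₀′-hi i = cong (byRole (λ i → ω₀ i + K) ω₀ n) (role-hi i)

  ω₀′-lo : ∀ i → ω₀′ (lo i) ≡ ω₀ i
  ω₀′-lo i = cong (byRole (λ i → ω₀ i + K) ω₀ n) (role-lo i)

  ω₀′-middle : ∀ {v} → role v ≡ middle → ω₀′ v ≡ n
  ω₀′-middle = cong (byRole (λ i → ω₀ i + K) ω₀ n)

  simulates-start : Simulates (const true) ω₀′ (const true) ω₀
  simulates-start = record
    { hi-dirty       = λ _ → refl
    ; hi-brushes     = ω₀′-hi
    ; lo-dirty       = λ _ → refl
    ; lo-brushes     = λ i → trans (ω₀′-lo i) (sym (nothingCleaned (ω₀ i)))
    ; middle-dirty   = λ _ → refl
    ; middle-brushes = λ v-mid → trans (ω₀′-middle v-mid) (sym (nothingCleaned n))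
    }
    where
    nothingCleaned : ∀ x → x + (n ∸ card {n} (const true)) ≡ x
    nothingCleaned x = trans (cong (λ c → x + (n ∸ c)) (card-all n)) (trans (cong (x +_) (n∸n≡0 n)) (+-identityʳ x))

  ω₀′-≤ : ∀ v → ω₀′ v ≤ 3 * n
  ω₀′-≤ v with roleView v
  ... | high i = begin
    ω₀′ (hi i)             ≡⟨ ω₀′-hi i ⟩
    ω₀ i + suc (n + n)     ≡⟨ +-suc (ω₀ i) (n + n) ⟩
    suc (ω₀ i) + (n + n)   ≤⟨ +-monoˡ-≤ (n + n) (ω₀<n i) ⟩
    n + (n + n)            ≡⟨ cong (λ m → n + (n + m)) (+-identityʳ n) ⟨
    3 * n                  ∎
    where open ≤-Reasoning
  ... | low i        = subst (_≤ 3 * n) (sym (ω₀′-lo i)) (≤-trans (<⇒≤ (ω₀<n i)) (m≤m+n n (2 * n)))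
  ... | middle v-mid = subst (_≤ 3 * n) (sym (ω₀′-middle v-mid)) (m≤m+n n (2 * n))

  brushes-ω₀′ : brushes ω₀′ ≡ 2 * brushes ω₀ + 3 * (n * n) + 2 * n
  brushes-ω₀′ = begin
    sumFin ω₀′                                       ≡⟨ sumFin-byRole ω₀′ n ω₀′-middle ⟩
    sumFin (ω₀′ ∘ hi) + sumFin (ω₀′ ∘ lo) + suc n * n ≡⟨ cong₂ (λ x y → x + y + suc n * n)
                                                              (sumFin-cong ω₀′-hi) (sumFin-cong ω₀′-lo) ⟩
    sumFin (λ i → ω₀ i + K) + S + suc n * n          ≡⟨ cong (λ x → x + S + suc n * n)
                                                          (trans (sumFin-distrib-+ ω₀ (const K))
                                                                 (cong (S +_) (sumFin-const n K))) ⟩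
    S + n * K + S + suc n * n                        ≡⟨ count S n ⟩
    2 * S + 3 * (n * n) + 2 * n                      ∎
    where
    open ≡-Reasoning
    S : ℕ
    S = sumFin ω₀
    count : ∀ s n → s + n * suc (n + n) + s + suc n * n ≡ 2 * s + 3 * (n * n) + 2 * n
    count = solve-∀

  exchange-final : ∀ {ωK ωK′} (π : Permutation′ n) → (∀ i → ωK i ≡ ω₀ (π ⟨$⟩ʳ i)) → Finished ωK ωK′ →
                   ∀ v → ωK′ v ≡ ω₀′ (exchange π ⟨$⟩ʳ v)
  exchange-final {ωK} {ωK′} π ωK≡ω₀∘π finished v with roleView v
  ... | high i = begin
    ωK′ (hi i)                 ≡⟨ hi-final i ⟩
    ωK i                       ≡⟨ ωK≡ω₀∘π i ⟩
    ω₀ (π ⟨$⟩ʳ i)              ≡⟨ ω₀′-lo (π ⟨$⟩ʳ i) ⟨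
    ω₀′ (lo (π ⟨$⟩ʳ i))        ≡⟨ cong ω₀′ (exchange-hi π i) ⟨
    ω₀′ (exchange π ⟨$⟩ʳ hi i) ∎
    where
    open ≡-Reasoning
    open Finished finished
  ... | low i = trans (lo-final i) (sym (trans (cong ω₀′ (exchange-lo π i)) (ω₀′-hi i)))
    where open Finished finished
  ... | middle v-mid = trans (middle-final v-mid) (sym (trans (cong ω₀′ (exchange-middle π v-mid)) (ω₀′-middle v-mid)))
    where open Finished finished

≤pred⇒< : ∀ {n x} → Fin n → x ≤ n ∸ 1 → x < n
≤pred⇒< {suc n} _ = s≤s

mainTheorem5 : (n : ℕ) (ω : Config n) → OneClique n ω →
    Σ (Config (3 * n + 1)) λ ω′ → OneClique (3 * n + 1) ω′ ×
      brushes ω′ ≡ 2 * brushes ω + 3 * (n * n) + 2 * n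
mainTheorem5 n ω (ω≤n∸1 , ωK , (DK , runs , DK≡∅) , π , ωK≡ω∘π) =
  let ωK′ , cleans , finished = simulate simulates-start runs DK≡∅ in
  ω₀′ , (ω₀′≤N∸1 , ωK′ , cleans , exchange π , exchange-final π ωK≡ω∘π finished) , brushes-ω₀′
  where
  open Layout n
  open Simulation n ω (λ i → ≤pred⇒< i (ω≤n∸1 i))

  ω₀′≤N∸1 : ∀ v → ω₀′ v ≤ N ∸ 1
  ω₀′≤N∸1 v = subst (ω₀′ v ≤_) (sym (m+n∸n≡m (3 * n) 1)) (ω₀′-≤ v)
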